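{- Let $A$ be an $n\times n\times n$ tristochastic array (nonnegative entries, every line summing to $1$) such that every line of $A$ contains exactly two entries equal to $\frac12$ and all other entries of that line are $0$. Let $G(A)$ be the graph whose vertex set is the set of index triples $(i,j,k)$ with $A(i,j,k)=\frac12$, two such triples being adjacent iff they lie on a common line. Then $A$ is a vertex of the polytope $\Omega^{(2)}_n$ of all $n\times n\times n$ tristochastic arrays if and only if no connected component of $G(A)$ is bipartite.
   Context: A line in an $n\times n\times n$ array $A$ is a set of $n$ entries obtained by fixing two of the three indices and letting the third range over $\{1,\dots,n\}$.
   Formalization: The polytope $\Omega^{(2)}_n$ consists only of tristochastic arrays with rational entries, and the convex weights in the definition of a vertex are rational. -}

module Defs where

open import Data.Nat using (ℕ; zero; suc)
open import Data.Fin using (Fin; zero; suc)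
open import Data.Product using (Σ; _×_; _,_; ∃-syntax)
open import Data.Sum using (_⊎_)
open import Data.Bool using (Bool)
open import Data.Rational using (ℚ; 0ℚ; 1ℚ; ½; _+_; _-_; _*_; _≤_; _<_)
open import Relation.Binary.PropositionalEquality using (_≡_; _≢_)
open import Relation.Nullary using (¬_)

Array : ℕ → Set
Array n = Fin n → Fin n → Fin n → ℚ

Triple : ℕ → Set
Triple n = Fin n × Fin n × Fin n

entry : ∀ {n} → Array n → Triple n → ℚ
entry A (i , j , k) = A i j k

sumℚ : ∀ n → (Fin n → ℚ) → ℚ
sumℚ zero    f = 0ℚ
sumℚ (suc n) f = f zero + sumℚ n (λ i → f (suc i))

AllLines : ∀ {n} → ((Fin n → ℚ) → Set) → Array n → Set
AllLines P A =
  (∀ j k → P (λ i → A i j k)) ×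
  (∀ i k → P (λ j → A i j k)) ×
  (∀ i j → P (λ k → A i j k))

Tristochastic : ∀ {n} → Array n → Set
Tristochastic {n} A =
  (∀ i j k → 0ℚ ≤ A i j k) × AllLines (λ f → sumℚ n f ≡ 1ℚ) A

TwoHalves : ∀ {n} → (Fin n → ℚ) → Set
TwoHalves {n} f =
  Σ (Fin n) λ a → Σ (Fin n) λ b →
    a ≢ b × f a ≡ ½ × f b ≡ ½ × (∀ c → c ≢ a → c ≢ b → f c ≡ 0ℚ)

IsVertex : ∀ {n} → Array n → Set
IsVertex {n} A =
  Tristochastic A ×
  (∀ (B C : Array n) (t : ℚ) → Tristochastic B → Tristochastic C →
     0ℚ < t → t < 1ℚ →
     (∀ i j k → A i j k ≡ t * B i j k + (1ℚ - t) * C i j k) →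
     ∀ i j k → B i j k ≡ C i j k)

OnCommonLine : ∀ {n} → Triple n → Triple n → Set
OnCommonLine (i , j , k) (i' , j' , k') =
  (j ≡ j' × k ≡ k') ⊎ (i ≡ i' × k ≡ k') ⊎ (i ≡ i' × j ≡ j')

GVertex : ∀ {n} → Array n → Triple n → Set
GVertex A u = entry A u ≡ ½

GAdj : ∀ {n} → Array n → Triple n → Triple n → Set
GAdj A u v = GVertex A u × GVertex A v × u ≢ v × OnCommonLine u v

data Connected {n} (A : Array n) (u : Triple n) : Triple n → Set where
  here : GVertex A u → Connected A u u
  step : ∀ {v w} → Connected A u v → GAdj A v w → Connected A u w

BipartiteComponent : ∀ {n} → Array n → Triple n → Set
BipartiteComponent {n} A v =
  Σ (Triple n → Bool) λ c →
    ∀ u w → Connected A v u → Connected A v w → GAdj A u w → c u ≢ c w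

-- If A = t B + (1 - t) C with B, C tristochastic, then B and C vanish where A
-- does, so on each line δ = B - C is supported on the two half-entries of A and
-- sums to 0: δ changes sign along every edge of G(A). Hence δ(v) ≠ 0 makes
-- u ↦ [δ u = δ v] a 2-colouring of the component of v. Conversely, a 2-colouring
-- κ of a component gives two distinct tristochastic arrays, equal to A off the
-- component and to the indicators of κ and of not ∘ κ on it, whose midpoint is A.
-- Membership in the component need not be decidable constructively: it is only
-- used inside the proof of a negation, where excluded middle is available.
{-# OPTIONS --safe #-}
module Submission where

open import Defs
open import Data.Nat using (ℕ; zero; suc)
open import Data.Fin using (Fin; zero; suc)
open import Data.Fin.Properties using (suc-injective) renaming (_≟_ to _≟ᶠ_)
open import Data.Product using (∃-syntax; _×_; _,_; proj₁; proj₂)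
open import Data.Sum using (_⊎_; inj₁; inj₂)
open import Data.Bool using (Bool; true; false; not; if_then_else_)
open import Data.Bool.Properties using (not-injective)
open import Data.Empty using (⊥; ⊥-elim)
open import Data.Rational using (ℚ; 0ℚ; 1ℚ; ½; _+_; _-_; _*_; -_; _≤_; _<_; positive; nonNegative)
open import Data.Rational.Properties
open import Data.Rational.Solver using (module +-*-Solver)
open import Algebra.Properties.Group +-0-group using (inverseʳ-unique; ⁻¹-involutive; x∙y⁻¹≈ε⇒x≈y)
open import Function using (_∘_)
open import Relation.Binary.PropositionalEquality
open import Relation.Nullary using (¬_; Dec; yes; no; does)
open import Relation.Nullary.Decidable using (toWitness; ¬¬-excluded-middle)

open +-*-Solver

private
  variable
    n : ℕ

0<½ : 0ℚ < ½
0<½ = toWitness {a? = 0ℚ <? ½} _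

½<1 : ½ < 1ℚ
½<1 = toWitness {a? = ½ <? 1ℚ} _

x+x≡0⇒x≡0 : ∀ x → x + x ≡ 0ℚ → x ≡ 0ℚ
x+x≡0⇒x≡0 x x+x≡0 = begin
  x             ≡⟨ solve 1 (λ x → x := con ½ :* (x :+ x)) refl x ⟩
  ½ * (x + x)   ≡⟨ cong (½ *_) x+x≡0 ⟩
  0ℚ            ∎
  where open ≡-Reasoning

½x+½x≡x : ∀ x → ½ * x + (1ℚ - ½) * x ≡ x
½x+½x≡x = solve 1 (λ x → con ½ :* x :+ (con 1ℚ :- con ½) :* x := x) refl

*-nonNeg : ∀ {p q} → 0ℚ ≤ p → 0ℚ ≤ q → 0ℚ ≤ p * q
*-nonNeg {p} {q} 0≤p 0≤q =
  subst (_≤ p * q) (*-zeroʳ p) (*-monoˡ-≤-nonNeg p {{nonNegative 0≤p}} 0≤q)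

nonNeg+nonNeg≡0⇒≡0 : ∀ {p q} → 0ℚ ≤ p → 0ℚ ≤ q → p + q ≡ 0ℚ → p ≡ 0ℚ
nonNeg+nonNeg≡0⇒≡0 {p} {q} 0≤p 0≤q p+q≡0 = ≤-antisym p≤0 0≤p
  where
  p≤0 : p ≤ 0ℚ
  p≤0 = subst₂ _≤_ (+-identityʳ p) p+q≡0 (+-monoʳ-≤ p 0≤q)

pos*≡0⇒≡0 : ∀ {t x} → 0ℚ < t → 0ℚ ≤ x → t * x ≡ 0ℚ → x ≡ 0ℚ
pos*≡0⇒≡0 {t} {x} 0<t 0≤x t*x≡0 =
  ≤-antisym (*-cancelˡ-≤-pos t {{positive 0<t}} (≤-reflexive (trans t*x≡0 (sym (*-zeroʳ t))))) 0≤x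

t<1⇒0<1-t : ∀ {t} → t < 1ℚ → 0ℚ < 1ℚ - t
t<1⇒0<1-t {t} t<1 = subst (_< 1ℚ - t) (+-inverseʳ t) (+-monoˡ-< (- t) t<1)

convex-combination≡0 : ∀ {t x y} → 0ℚ < t → t < 1ℚ → 0ℚ ≤ x → 0ℚ ≤ y →
  t * x + (1ℚ - t) * y ≡ 0ℚ → x ≡ 0ℚ × y ≡ 0ℚ
convex-combination≡0 {t} {x} {y} 0<t t<1 0≤x 0≤y sum≡0 =
  pos*≡0⇒≡0 0<t 0≤x (nonNeg+nonNeg≡0⇒≡0 0≤tx 0≤sy sum≡0) ,
  pos*≡0⇒≡0 0<s 0≤y (nonNeg+nonNeg≡0⇒≡0 0≤sy 0≤tx (trans (+-comm ((1ℚ - t) * y) (t * x)) sum≡0))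
  where
  0<s : 0ℚ < 1ℚ - t
  0<s = t<1⇒0<1-t t<1
  0≤tx : 0ℚ ≤ t * x
  0≤tx = *-nonNeg (<⇒≤ 0<t) 0≤x
  0≤sy : 0ℚ ≤ (1ℚ - t) * y
  0≤sy = *-nonNeg (<⇒≤ 0<s) 0≤y

sumℚ-zero : ∀ n (f : Fin n → ℚ) → (∀ c → f c ≡ 0ℚ) → sumℚ n f ≡ 0ℚ
sumℚ-zero zero    f f≡0 = refl
sumℚ-zero (suc n) f f≡0 =
  cong₂ _+_ (f≡0 zero) (sumℚ-zero n (f ∘ suc) (f≡0 ∘ suc))

sumℚ-one : ∀ n (f : Fin n → ℚ) x → (∀ c → c ≢ x → f c ≡ 0ℚ) → sumℚ n f ≡ f x
sumℚ-one (suc n) f zero    f≡0 =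
  trans (cong (f zero +_) (sumℚ-zero n (f ∘ suc) (λ c → f≡0 (suc c) λ ()))) (+-identityʳ _)
sumℚ-one (suc n) f (suc x) f≡0 =
  trans (cong₂ _+_ (f≡0 zero λ ()) (sumℚ-one n (f ∘ suc) x (λ c c≢x → f≡0 (suc c) (c≢x ∘ suc-injective))))
        (+-identityˡ _)

sumℚ-two : ∀ n (f : Fin n → ℚ) x y → x ≢ y → (∀ c → c ≢ x → c ≢ y → f c ≡ 0ℚ) →
  sumℚ n f ≡ f x + f y
sumℚ-two (suc n) f zero    zero    x≢y f≡0 = ⊥-elim (x≢y refl)
sumℚ-two (suc n) f zero    (suc y) x≢y f≡0 =
  cong (f zero +_) (sumℚ-one n (f ∘ suc) y (λ c c≢y → f≡0 (suc c) (λ ()) (c≢y ∘ suc-injective)))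
sumℚ-two (suc n) f (suc x) zero    x≢y f≡0 =
  trans (cong (f zero +_) (sumℚ-one n (f ∘ suc) x (λ c c≢x → f≡0 (suc c) (c≢x ∘ suc-injective) (λ ()))))
        (+-comm (f zero) (f (suc x)))
sumℚ-two (suc n) f (suc x) (suc y) x≢y f≡0 =
  trans (cong₂ _+_ (f≡0 zero (λ ()) (λ ()))
                   (sumℚ-two n (f ∘ suc) x y (x≢y ∘ cong suc)
                      (λ c c≢x c≢y → f≡0 (suc c) (c≢x ∘ suc-injective) (c≢y ∘ suc-injective))))
        (+-identityˡ _)

sumℚ-difference : ∀ n (f g : Fin n → ℚ) → sumℚ n (λ c → f c - g c) ≡ sumℚ n f - sumℚ n g
sumℚ-difference zero    f g = refl
sumℚ-difference (suc n) f g = begin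
  (f zero - g zero) + sumℚ n (λ c → f (suc c) - g (suc c))
    ≡⟨ cong ((f zero - g zero) +_) (sumℚ-difference n (f ∘ suc) (g ∘ suc)) ⟩
  (f zero - g zero) + (sumℚ n (f ∘ suc) - sumℚ n (g ∘ suc))
    ≡⟨ solve 4 (λ a b c d → (a :- c) :+ (b :- d) := (a :+ b) :- (c :+ d)) refl
         (f zero) (sumℚ n (f ∘ suc)) (g zero) (sumℚ n (g ∘ suc)) ⟩
  (f zero + sumℚ n (f ∘ suc)) - (g zero + sumℚ n (g ∘ suc))
    ∎
  where open ≡-Reasoning

½≢0 : ½ ≢ 0ℚ
½≢0 ()

twoHalves-halfAt : ∀ {f : Fin n → ℚ} (halves : TwoHalves f) →
  ∀ c → f c ≡ ½ → c ≡ proj₁ halves ⊎ c ≡ proj₁ (proj₂ halves)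
twoHalves-halfAt (a , b , _ , _ , _ , rest) c fc≡½ with c ≟ᶠ a | c ≟ᶠ b
... | yes c≡a | _       = inj₁ c≡a
... | no _    | yes c≡b = inj₂ c≡b
... | no c≢a  | no c≢b  = ⊥-elim (½≢0 (trans (sym fc≡½) (rest c c≢a c≢b)))

twoHalves-halfOrZero : ∀ {f : Fin n → ℚ} → TwoHalves f → ∀ c → f c ≡ ½ ⊎ f c ≡ 0ℚ
twoHalves-halfOrZero (a , b , _ , fa≡½ , fb≡½ , rest) c with c ≟ᶠ a | c ≟ᶠ b
... | yes refl | _        = inj₁ fa≡½
... | no _     | yes refl = inj₁ fb≡½
... | no c≢a   | no c≢b   = inj₂ (rest c c≢a c≢b)

pigeonhole : ∀ {A : Set} {a b x y z : A} → x ≡ a ⊎ x ≡ b → y ≡ a ⊎ y ≡ b → z ≡ a ⊎ z ≡ b →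
  x ≢ y → z ≢ x → z ≢ y → ⊥
pigeonhole (inj₁ refl) (inj₁ refl) _          x≢y _   _   = x≢y refl
pigeonhole (inj₂ refl) (inj₂ refl) _          x≢y _   _   = x≢y refl
pigeonhole (inj₁ refl) (inj₂ refl) (inj₁ refl) _  z≢x _   = z≢x refl
pigeonhole (inj₁ refl) (inj₂ refl) (inj₂ refl) _  _   z≢y = z≢y refl
pigeonhole (inj₂ refl) (inj₁ refl) (inj₁ refl) _  _   z≢y = z≢y refl
pigeonhole (inj₂ refl) (inj₁ refl) (inj₂ refl) _  z≢x _   = z≢x refl

twoHalves-zeroOutside : ∀ {f : Fin n → ℚ} → TwoHalves f → ∀ {x y} → x ≢ y → f x ≡ ½ → f y ≡ ½ →
  ∀ c → c ≢ x → c ≢ y → f c ≡ 0ℚ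
twoHalves-zeroOutside {f = f} halves x≢y fx≡½ fy≡½ c c≢x c≢y with twoHalves-halfOrZero halves c
... | inj₂ fc≡0 = fc≡0
... | inj₁ fc≡½ = ⊥-elim (pigeonhole (halfAt _ fx≡½) (halfAt _ fy≡½) (halfAt c fc≡½) x≢y c≢x c≢y)
  where
  halfAt : ∀ z → f z ≡ ½ → z ≡ proj₁ halves ⊎ z ≡ proj₁ (proj₂ halves)
  halfAt = twoHalves-halfAt halves

data Line (n : ℕ) : Set where
  i-line : (j k : Fin n) → Line n
  j-line : (i k : Fin n) → Line n
  k-line : (i j : Fin n) → Line n

point : Line n → Fin n → Triple n
point (i-line j k) i = i , j , k
point (j-line i k) j = i , j , k
point (k-line i j) k = i , j , k

_along_ : Array n → Line n → Fin n → ℚ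
(A along L) x = entry A (point L x)

line : ∀ (P : (Fin n → ℚ) → Set) {A : Array n} → AllLines P A → ∀ L → P (A along L)
line P (P₁ , P₂ , P₃) (i-line j k) = P₁ j k
line P (P₁ , P₂ , P₃) (j-line i k) = P₂ i k
line P (P₁ , P₂ , P₃) (k-line i j) = P₃ i j

allLines : ∀ (P : (Fin n → ℚ) → Set) {A : Array n} → (∀ L → P (A along L)) → AllLines P A
allLines P PL = (λ j k → PL (i-line j k)) , (λ i k → PL (j-line i k)) , (λ i j → PL (k-line i j))

point-injective : ∀ L {x y : Fin n} → point L x ≡ point L y → x ≡ y
point-injective (i-line j k) refl = refl
point-injective (j-line i k) refl = refl
point-injective (k-line i j) refl = refl

point-onCommonLine : ∀ L (x y : Fin n) → OnCommonLine (point L x) (point L y)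
point-onCommonLine (i-line j k) x y = inj₁ (refl , refl)
point-onCommonLine (j-line i k) x y = inj₂ (inj₁ (refl , refl))
point-onCommonLine (k-line i j) x y = inj₂ (inj₂ (refl , refl))

onCommonLine⇒points : ∀ {u w : Triple n} → OnCommonLine u w →
  ∃[ L ] ∃[ x ] ∃[ y ] (point L x ≡ u × point L y ≡ w)
onCommonLine⇒points {u = i , j , k} {i' , _ , _} (inj₁ (refl , refl))        = i-line j k , i , i' , refl , refl
onCommonLine⇒points {u = i , j , k} {_ , j' , _} (inj₂ (inj₁ (refl , refl))) = j-line i k , j , j' , refl , refl
onCommonLine⇒points {u = i , j , k} {_ , _ , k'} (inj₂ (inj₂ (refl , refl))) = k-line i j , k , k' , refl , refl

module _ {A : Array n} where

  connected⇒GVertex : ∀ {v u} → Connected A v u → GVertex A u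
  connected⇒GVertex (here gu)            = gu
  connected⇒GVertex (step _ (_ , gu , _)) = gu

  adjacent-along : ∀ L {x y} → x ≢ y → GVertex A (point L x) → GVertex A (point L y) →
    GAdj A (point L x) (point L y)
  adjacent-along L x≢y gx gy = gx , gy , x≢y ∘ point-injective L , point-onCommonLine L _ _

  tristochastic-nonNeg : Tristochastic A → ∀ u → 0ℚ ≤ entry A u
  tristochastic-nonNeg (nonNeg , _) (i , j , k) = nonNeg i j k

  tristochastic-sum-along : Tristochastic A → ∀ L → sumℚ n (A along L) ≡ 1ℚ
  tristochastic-sum-along (_ , sums) = line (λ f → sumℚ n f ≡ 1ℚ) sums

ProperColouring : Array n → Triple n → (Triple n → Bool) → Set
ProperColouring A v κ = ∀ u w → Connected A v u → Connected A v w → GAdj A u w → κ u ≢ κ w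

module ConvexDecomposition
  {A B C : Array n} {t : ℚ} (halves : AllLines TwoHalves A)
  (B-tri : Tristochastic B) (C-tri : Tristochastic C) (0<t : 0ℚ < t) (t<1 : t < 1ℚ)
  (A≡tB+[1-t]C : ∀ i j k → A i j k ≡ t * B i j k + (1ℚ - t) * C i j k) where

  δ : Triple n → ℚ
  δ u = entry B u - entry C u

  vanishes-with-A : ∀ u → entry A u ≡ 0ℚ → entry B u ≡ 0ℚ × entry C u ≡ 0ℚ
  vanishes-with-A u@(i , j , k) Au≡0 =
    convex-combination≡0 0<t t<1 (tristochastic-nonNeg B-tri u) (tristochastic-nonNeg C-tri u)
      (trans (sym (A≡tB+[1-t]C i j k)) Au≡0)

  δ-sum-along : ∀ L → sumℚ n (λ x → δ (point L x)) ≡ 0ℚ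
  δ-sum-along L = begin
    sumℚ n (λ x → δ (point L x))            ≡⟨ sumℚ-difference n (B along L) (C along L) ⟩
    sumℚ n (B along L) - sumℚ n (C along L)  ≡⟨ cong₂ _-_ (tristochastic-sum-along B-tri L)
                                                          (tristochastic-sum-along C-tri L) ⟩
    1ℚ - 1ℚ                                  ≡⟨ +-inverseʳ 1ℚ ⟩
    0ℚ                                       ∎
    where open ≡-Reasoning

  δ-edge-along : ∀ L {x y} → x ≢ y → GVertex A (point L x) → GVertex A (point L y) →
    δ (point L x) + δ (point L y) ≡ 0ℚ
  δ-edge-along L {x} {y} x≢y gx gy =
    trans (sym (sumℚ-two n (λ c → δ (point L c)) x y x≢y δ≡0)) (δ-sum-along L)
    where
    δ≡0 : ∀ c → c ≢ x → c ≢ y → δ (point L c) ≡ 0ℚ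
    δ≡0 c c≢x c≢y
      with Bc≡0 , Cc≡0 ← vanishes-with-A (point L c)
             (twoHalves-zeroOutside (line TwoHalves halves L) x≢y gx gy c c≢x c≢y)
      = cong₂ _-_ Bc≡0 Cc≡0

  δ-edge : ∀ {u w} → GAdj A u w → δ w ≡ - δ u
  δ-edge (gu , gw , u≢w , collinear) with onCommonLine⇒points collinear
  ... | L , x , y , refl , refl =
    inverseʳ-unique (δ (point L x)) (δ (point L y)) (δ-edge-along L (u≢w ∘ cong (point L)) gu gw)

  δ-walk : ∀ {v u} → Connected A v u → δ u ≡ δ v ⊎ δ u ≡ - δ v
  δ-walk (here _) = inj₁ refl
  δ-walk {v} (step walk adj) with δ-walk walk
  ... | inj₁ δu≡δv  = inj₂ (trans (δ-edge adj) (cong -_ δu≡δv))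
  ... | inj₂ δu≡-δv = inj₁ (trans (δ-edge adj) (trans (cong -_ δu≡-δv) (⁻¹-involutive (δ v))))

  δ≢0⇒bipartite : ∀ v → δ v ≢ 0ℚ → BipartiteComponent A v
  δ≢0⇒bipartite v δv≢0 = colour , proper
    where
    colour : Triple n → Bool
    colour u = does (δ u ≟ δ v)

    sameColour⇒δ≡ : ∀ {u w} → Connected A v u → Connected A v w → colour u ≡ colour w → δ u ≡ δ w
    sameColour⇒δ≡ {u} {w} vu vw same with δ u ≟ δ v | δ w ≟ δ v | δ-walk vu | δ-walk vw
    ... | yes δu≡δv | yes δw≡δv | _            | _            = trans δu≡δv (sym δw≡δv)
    ... | no δu≢δv  | no δw≢δv  | inj₂ δu≡-δv  | inj₂ δw≡-δv  = trans δu≡-δv (sym δw≡-δv)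
    ... | no δu≢δv  | no _      | inj₁ δu≡δv   | _            = ⊥-elim (δu≢δv δu≡δv)
    ... | no _      | no δw≢δv  | _            | inj₁ δw≡δv   = ⊥-elim (δw≢δv δw≡δv)

    δv≡0 : ∀ {u} → Connected A v u → δ u ≡ 0ℚ → δ v ≡ 0ℚ
    δv≡0 vu δu≡0 with δ-walk vu
    ... | inj₁ δu≡δv  = trans (sym δu≡δv) δu≡0
    ... | inj₂ δu≡-δv = neg-injective (trans (sym δu≡-δv) δu≡0)

    proper : ProperColouring A v colour
    proper u w vu vw adj same = δv≢0 (δv≡0 vu (x+x≡0⇒x≡0 (δ u) δu+δu≡0))
      where
      δu+δu≡0 : δ u + δ u ≡ 0ℚ
      δu+δu≡0 = trans (cong (δ u +_) (sameColour⇒δ≡ vu vw same))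
                      (trans (cong (δ u +_) (δ-edge adj)) (+-inverseʳ (δ u)))

  noBipartiteComponent⇒B≡C : (∀ v → GVertex A v → ¬ BipartiteComponent A v) →
    ∀ i j k → B i j k ≡ C i j k
  noBipartiteComponent⇒B≡C noBipartite i j k = x∙y⁻¹≈ε⇒x≈y (B i j k) (C i j k) δu≡0
    where
    u : Triple n
    u = (i , j , k)
    δu≡0 : δ u ≡ 0ℚ
    δu≡0 with twoHalves-halfOrZero (line TwoHalves halves (k-line i j)) k | δ u ≟ 0ℚ
    ... | _         | yes δu≡0 = δu≡0
    ... | inj₁ Au≡½ | no δu≢0  = ⊥-elim (noBipartite u Au≡½ (δ≢0⇒bipartite u δu≢0))
    ... | inj₂ Au≡0 | no _     with Bu≡0 , Cu≡0 ← vanishes-with-A u Au≡0 = cong₂ _-_ Bu≡0 Cu≡0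

noBipartiteComponent⇒vertex : ∀ {A : Array n} → Tristochastic A → AllLines TwoHalves A →
  (∀ v → GVertex A v → ¬ BipartiteComponent A v) → IsVertex A
noBipartiteComponent⇒vertex tri halves noBipartite =
  tri , λ B C t B-tri C-tri 0<t t<1 A≡tB+[1-t]C →
    ConvexDecomposition.noBipartiteComponent⇒B≡C halves B-tri C-tri 0<t t<1 A≡tB+[1-t]C noBipartite

indicator : Bool → ℚ
indicator true  = 1ℚ
indicator false = 0ℚ

indicator-nonNeg : ∀ b → 0ℚ ≤ indicator b
indicator-nonNeg true  = toWitness {a? = 0ℚ ≤? 1ℚ} _
indicator-nonNeg false = ≤-refl

indicator-complement : ∀ {b b'} → b ≢ b' → indicator b + indicator b' ≡ 1ℚ
indicator-complement {true}  {true}  b≢b' = ⊥-elim (b≢b' refl)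
indicator-complement {true}  {false} _    = refl
indicator-complement {false} {true}  _    = refl
indicator-complement {false} {false} b≢b' = ⊥-elim (b≢b' refl)

indicator-midpoint : ∀ b → ½ * indicator b + (1ℚ - ½) * indicator (not b) ≡ ½
indicator-midpoint true  = refl
indicator-midpoint false = refl

indicator-not : ∀ b → indicator b ≢ indicator (not b)
indicator-not true  ()
indicator-not false ()

not-proper : ∀ {A : Array n} {v κ} → ProperColouring A v κ → ProperColouring A v (not ∘ κ)
not-proper proper u w vu vw adj = proper u w vu vw adj ∘ not-injective

¬¬-∀-Fin : ∀ {n} {P : Fin n → Set} → (∀ x → ¬ ¬ P x) → ¬ ¬ (∀ x → P x)
¬¬-∀-Fin {zero}  ¬¬P ¬∀P = ¬∀P λ ()
¬¬-∀-Fin {suc n} ¬¬P ¬∀P =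
  ¬¬P zero λ P0 → ¬¬-∀-Fin (¬¬P ∘ suc) λ Psuc → ¬∀P λ { zero → P0 ; (suc x) → Psuc x }

¬¬-decidable : (P : Triple n → Set) → ¬ ¬ (∀ u → Dec (P u))
¬¬-decidable P ¬dec =
  ¬¬-∀-Fin (λ i → ¬¬-∀-Fin λ j → ¬¬-∀-Fin λ k → ¬¬-excluded-middle)
    λ dec → ¬dec λ { (i , j , k) → dec i j k }

module Splitting
  {A : Array n} (tri : Tristochastic A) (halves : AllLines TwoHalves A)
  (v : Triple n) (inComponent? : ∀ u → Dec (Connected A v u)) where

  splitEntry : (Triple n → Bool) → Triple n → ℚ
  splitEntry κ u = if does (inComponent? u) then indicator (κ u) else entry A u

  split : (Triple n → Bool) → Array n
  split κ i j k = splitEntry κ (i , j , k)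

  split-vanishes : ∀ κ u → entry A u ≡ 0ℚ → splitEntry κ u ≡ 0ℚ
  split-vanishes κ u Au≡0 with inComponent? u
  ... | yes vu = ⊥-elim (½≢0 (trans (sym (connected⇒GVertex vu)) Au≡0))
  ... | no _   = Au≡0

  split-nonNeg : ∀ κ u → 0ℚ ≤ splitEntry κ u
  split-nonNeg κ u with inComponent? u
  ... | yes _ = indicator-nonNeg (κ u)
  ... | no _  = tristochastic-nonNeg tri u

  split-sum-along : ∀ {κ} → ProperColouring A v κ → ∀ L → sumℚ n (split κ along L) ≡ 1ℚ
  split-sum-along {κ} proper L with line TwoHalves halves L
  ... | a , b , a≢b , Aa≡½ , Ab≡½ , rest =
    trans (sumℚ-two n _ a b a≢b (λ c c≢a c≢b → split-vanishes κ _ (rest c c≢a c≢b))) endpoints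
    where
    ab : GAdj A (point L a) (point L b)
    ab = adjacent-along {A = A} L a≢b Aa≡½ Ab≡½
    ba : GAdj A (point L b) (point L a)
    ba = adjacent-along {A = A} L (a≢b ∘ sym) Ab≡½ Aa≡½

    endpoints : splitEntry κ (point L a) + splitEntry κ (point L b) ≡ 1ℚ
    endpoints with inComponent? (point L a) | inComponent? (point L b)
    ... | yes va | yes vb = indicator-complement (proper _ _ va vb ab)
    ... | yes va | no ¬vb = ⊥-elim (¬vb (step va ab))
    ... | no ¬va | yes vb = ⊥-elim (¬va (step vb ba))
    ... | no _   | no _   = cong₂ _+_ Aa≡½ Ab≡½

  split-tristochastic : ∀ {κ} → ProperColouring A v κ → Tristochastic (split κ)
  split-tristochastic {κ} proper =
    (λ i j k → split-nonNeg κ (i , j , k)) , allLines (λ f → sumℚ n f ≡ 1ℚ) (split-sum-along proper)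

  A≡midpoint : ∀ κ i j k → A i j k ≡ ½ * split κ i j k + (1ℚ - ½) * split (not ∘ κ) i j k
  A≡midpoint κ i j k with inComponent? (i , j , k)
  ... | yes vu = trans (connected⇒GVertex vu) (sym (indicator-midpoint (κ (i , j , k))))
  ... | no _   = sym (½x+½x≡x (A i j k))

  split-differs : ∀ κ → GVertex A v → splitEntry κ v ≢ splitEntry (not ∘ κ) v
  split-differs κ gv with inComponent? v
  ... | yes _ = indicator-not (κ v)
  ... | no ¬vv = λ _ → ¬vv (here gv)

vertex⇒noBipartiteComponent : ∀ {A : Array n} → Tristochastic A → AllLines TwoHalves A →
  IsVertex A → ∀ v → GVertex A v → ¬ BipartiteComponent A v
vertex⇒noBipartiteComponent {A = A} tri halves (_ , extreme) v@(i , j , k) gv (κ , proper) =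
  ¬¬-decidable (Connected A v) λ inComponent? →
    let open Splitting tri halves v inComponent? in
    split-differs κ gv
      (extreme (split κ) (split (not ∘ κ)) ½ (split-tristochastic proper)
         (split-tristochastic (not-proper proper)) 0<½ ½<1 (A≡midpoint κ) i j k)

mainTheorem2 : ∀ (n : ℕ) (A : Array n) →
    Tristochastic A → AllLines TwoHalves A →
    (IsVertex A → ∀ v → GVertex A v → ¬ BipartiteComponent A v) ×
    ((∀ v → GVertex A v → ¬ BipartiteComponent A v) → IsVertex A)
mainTheorem2 n A tri halves =
  vertex⇒noBipartiteComponent tri halves , noBipartiteComponent⇒vertex tri halves
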